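{- For every nonnegative integer $t$, the set of permutations of tier at most $t$ is a permutation class, i.e., it is closed under pattern containment. Equivalently, for every positive integer $k$, the set of $k$-pass sortable permutations is a permutation class.
   Context: A permutation $\rho=\rho_1\cdots\rho_n$ contains $\sigma=\sigma_1\cdots\sigma_k$ if there are indices $\alpha_1<\cdots<\alpha_k$ with $\rho_{\alpha_i}<\rho_{\alpha_j}$ iff $\sigma_i<\sigma_j$; a permutation class is a set of permutations closed downward under containment. Multi-pass stack sorting: in a pass, the entries of the current input are pushed one at a time, in order, onto a stack; whenever the top of the stack is the smallest value not yet output, it is popped to the output (repeatedly); entries are never popped otherwise. When all input entries have been pushed and no pop is possible, if the stack is nonempty the remaining entries are returned to the input in their original relative order and a new pass begins. A permutation is $k$-pass sortable if it is sorted (output $1,\dots,n$) using at most $k$ passes; its tier is one less than the minimum number of passes needed. -}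

module Defs where

open import Data.Nat using (ℕ; zero; suc; _<_; _≤_)
open import Data.Nat.Properties using (_≟_)
open import Data.List using (List; []; _∷_; _++_; length; map; upTo; reverse; lookup)
open import Data.List.Relation.Binary.Permutation.Propositional using (_↭_)
open import Data.List.Relation.Binary.Sublist.Propositional using (_⊆_)
open import Data.Product using (Σ; _×_; _,_; proj₁; proj₂)
open import Data.Fin using (Fin; cast)
open import Function.Bundles using (_⇔_)
open import Relation.Nullary using (yes; no)
open import Relation.Binary.PropositionalEquality using (_≡_)

IsPerm : List ℕ → Set
IsPerm ρ = ρ ↭ map suc (upTo (length ρ))

Contains : List ℕ → List ℕ → Set
Contains ρ σ =
  Σ (List ℕ) λ τ → Σ (τ ⊆ ρ) λ _ → Σ (length σ ≡ length τ) λ eq →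
    ∀ (i j : Fin (length σ)) →
      (lookup τ (cast eq i) < lookup τ (cast eq j)) ⇔ (lookup σ i < lookup σ j)

IsPermClass : (List ℕ → Set) → Set
IsPermClass S = ∀ ρ σ → IsPerm ρ → IsPerm σ → S ρ → Contains ρ σ → S σ

-- Multi-pass stack sorting.
-- State of the machine between passes: the smallest value not yet output
-- ("next"), the output so far, and the current input.

record State : Set where
  constructor st
  field
    next  : ℕ
    out   : List ℕ
    input : List ℕ
open State public

popAll : ℕ → List ℕ → List ℕ → ℕ × List ℕ × List ℕ
popAll nx out [] = nx , out , []
popAll nx out (x ∷ s) with x ≟ nx
... | yes _ = popAll (suc nx) (out ++ (x ∷ [])) s
... | no _  = nx , out , x ∷ s

pushAll : ℕ → List ℕ → List ℕ → List ℕ → ℕ × List ℕ × List ℕ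
pushAll nx out s [] = nx , out , s
pushAll nx out s (x ∷ xs) with popAll nx out (x ∷ s)
... | nx' , out' , s' = pushAll nx' out' s' xs

-- One pass: afterwards the remaining stack entries are returned to the input
-- in their original relative order (the stack reversed, since its top is
-- the most recently pushed entry).
pass : State → State
pass (st nx out inp) with pushAll nx out [] inp
... | nx' , out' , s' = st nx' out' (reverse s')

passes : ℕ → State → State
passes zero    σ = σ
passes (suc k) σ = passes k (pass σ)

initial : List ℕ → State
initial ρ = st 1 [] ρ

-- ρ is k-pass sortable: after at most k passes the output is 1,2,…,n.
-- (Once the input is empty no further pass changes the state, so
-- "at most k passes" is the same as running k passes.)
SortableIn : ℕ → List ℕ → Set
SortableIn k ρ = out (passes k (initial ρ)) ≡ map suc (upTo (length ρ))

module Submission where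

open import Defs
open import Data.Nat using (ℕ; zero; suc; _≤_; _<_; z≤n; s≤s; s≤s⁻¹)
open import Data.Nat.Properties
  using ( _≟_; _<?_; _≤?_; ≤-refl; ≤-reflexive; ≤-trans; ≤-antisym; <-trans; <-irrefl
        ; ≤-<-trans; <-≤-trans; ≤∧≢⇒<; ≰⇒>; ≮⇒≥; m≤n⇒m≤1+n; m≤n⇒m<n∨m≡n; n<1+n
        ; suc-injective)
open import Data.List
  using (List; []; _∷_; [_]; _++_; _ʳ++_; length; map; upTo; reverse; filter; tabulate; lookup)
open import Data.List.Properties
  using ( unfold-reverse; reverse-++; reverse-involutive; filter-++; filter-accept; filter-reject
        ; filter-all; upTo-∷ʳ; map-++; map-tabulate; tabulate-lookup; length-map; length-upTo)
open import Data.List.Membership.Propositional using (_∈_; _∉_)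
open import Data.List.Membership.Propositional.Properties
  using (∈-map⁺; ∈-map⁻; ∈-upTo⁺; ∈-upTo⁻; ∈-filter⁺; ∈-filter⁻; ∈-tabulate⁻)
open import Data.List.Relation.Unary.Any using (here; there)
import Data.List.Relation.Unary.Any.Properties as Any
open import Data.List.Relation.Unary.All using (All; []; _∷_) renaming (tabulate to all-tabulate)
open import Data.List.Relation.Unary.All.Properties using (all-filter)
open import Data.List.Relation.Unary.Unique.Propositional using (Unique; _∷_)
import Data.List.Relation.Unary.Unique.Propositional.Properties as Unique
open import Data.List.Relation.Binary.Sublist.Propositional
  using (_⊆_; []; _∷_; _∷ʳ_; ⊆-trans; from∈) renaming (lookup to ∈-resp-⊆)
import Data.List.Relation.Binary.Sublist.Propositional.Properties as Sublist
open import Data.List.Relation.Binary.Permutation.Propositional using (_↭_; ↭-sym; ↭⇒↭ₛ)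
open import Data.List.Relation.Binary.Permutation.Propositional.Properties using (∈-resp-↭; ↭-reverse)
import Data.List.Relation.Binary.Permutation.Setoid.Properties as PermutationSetoid
open import Data.Fin using (Fin; cast)
open import Data.Product using (∃; ∃₂; _×_; _,_; proj₁; proj₂)
open import Data.Sum using (_⊎_; inj₁; inj₂; [_,_]′)
open import Data.Empty using (⊥-elim)
open import Function using (_∘_; _⇔_; case_of_)
open import Function.Bundles using (module Equivalence)
open import Relation.Nullary using (¬_; yes; no)
open import Relation.Unary using (Pred; Decidable)
open import Relation.Binary.PropositionalEquality
  using (_≡_; _≢_; refl; sym; trans; cong; cong₂; subst; setoid; module ≡-Reasoning)
open import Level using (Level)

-- After any number of passes the state is determined by the number c of entries output so
-- far: the output is 1,…,c and the input consists of the entries above c, in their original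
-- order.  A pass started there outputs c+1, c+2, … up to the first value that is either
-- absent or blocked, i.e. followed in the input by a larger entry and then by a smaller one:
-- the larger entry is pushed on top of it before it can be popped, and stays there until the
-- pass ends.  If σ occurs in ρ, a blocked entry of σ's remaining input yields, through the
-- order isomorphism, a blocked entry of ρ's remaining input, as long as every entry of σ
-- whose partner in ρ has been output has been output itself.  By induction on the passes
-- this last property is preserved, so σ is sorted as soon as ρ is.

private variable
  ℓa ℓp ℓq : Level
  A B : Set ℓa

module _ {P : Pred A ℓp} (P? : Decidable P) where

  filter-reverse : ∀ xs → filter P? (reverse xs) ≡ reverse (filter P? xs)
  filter-reverse [] = refl
  filter-reverse (x ∷ xs) = begin
    filter P? (reverse (x ∷ xs))                        ≡⟨ cong (filter P?) (unfold-reverse x xs) ⟩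
    filter P? (reverse xs ++ [ x ])                     ≡⟨ filter-++ P? (reverse xs) [ x ] ⟩
    filter P? (reverse xs) ++ filter P? [ x ]           ≡⟨ cong₂ _++_ (filter-reverse xs) [x]-self-reverse ⟩
    reverse (filter P? xs) ++ reverse (filter P? [ x ]) ≡⟨ reverse-++ (filter P? [ x ]) (filter P? xs) ⟨
    reverse (filter P? [ x ] ++ filter P? xs)           ≡⟨ cong reverse (filter-++ P? [ x ] xs) ⟨
    reverse (filter P? (x ∷ xs))                        ∎
    where
    open ≡-Reasoning
    [x]-self-reverse : filter P? [ x ] ≡ reverse (filter P? [ x ])
    [x]-self-reverse with P? x
    ... | yes _ = refl
    ... | no  _ = refl

  ⊆-filter⁺ : ∀ {xs ys} → xs ⊆ ys → All P xs → xs ⊆ filter P? ys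
  ⊆-filter⁺ xs⊆ys Pxs =
    subst (_⊆ _) (filter-all P? Pxs) (Sublist.filter⁺ P? P? (λ { refl p → p }) xs⊆ys)

  module _ {Q : Pred A ℓq} (Q? : Decidable Q) (Q⇒P : ∀ {x} → Q x → P x) where

    filter-filter-⇒ : ∀ xs → filter Q? (filter P? xs) ≡ filter Q? xs
    filter-filter-⇒ [] = refl
    filter-filter-⇒ (x ∷ xs) with P? x
    ... | yes _ with Q? x
    ...   | yes _ = cong (x ∷_) (filter-filter-⇒ xs)
    ...   | no  _ = filter-filter-⇒ xs
    filter-filter-⇒ (x ∷ xs) | no ¬Px with Q? x
    ...   | yes Qx = ⊥-elim (¬Px (Q⇒P Qx))
    ...   | no  _  = filter-filter-⇒ xs

Unique-resp-↭ : {xs ys : List A} → xs ↭ ys → Unique xs → Unique ys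
Unique-resp-↭ {A = A} xs↭ys = PermutationSetoid.Unique-resp-↭ (setoid A) (↭⇒↭ₛ xs↭ys)

Unique-ʳ++⁻ : ∀ (xs : List A) {ys} → Unique (xs ʳ++ ys) → Unique ys
Unique-ʳ++⁻ []       u = u
Unique-ʳ++⁻ (x ∷ xs) u with Unique-ʳ++⁻ xs u
... | _ ∷ u′ = u′

⊆-map⁻ : (f : A → B) (zs : List A) {xs : List B} →
         xs ⊆ map f zs → ∃ λ ys → ys ⊆ zs × map f ys ≡ xs
⊆-map⁻ f []       []             = [] , [] , refl
⊆-map⁻ f (z ∷ zs) (_ ∷ʳ xs⊆)    with ⊆-map⁻ f zs xs⊆
... | ys , ys⊆zs , eq = ys , z ∷ʳ ys⊆zs , eq
⊆-map⁻ f (z ∷ zs) (refl ∷ xs⊆) with ⊆-map⁻ f zs xs⊆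
... | ys , ys⊆zs , eq = z ∷ ys , refl ∷ ys⊆zs , cong (f z ∷_) eq

tabulate-lookup-cast : ∀ {n} (xs : List A) (eq : n ≡ length xs) → tabulate (lookup xs ∘ cast eq) ≡ xs
tabulate-lookup-cast {n = zero}  []       eq = refl
tabulate-lookup-cast {n = suc n} (x ∷ xs) eq = cong (x ∷_) (tabulate-lookup-cast xs (suc-injective eq))

∈-IsPerm⁻ : ∀ {σ x} → IsPerm σ → x ∈ σ → 0 < x × x ≤ length σ
∈-IsPerm⁻ σ-perm x∈σ with ∈-map⁻ suc (∈-resp-↭ σ-perm x∈σ)
... | i , i∈ , refl = s≤s z≤n , ∈-upTo⁻ i∈

∈-IsPerm⁺ : ∀ {σ x} → IsPerm σ → 0 < x → x ≤ length σ → x ∈ σ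
∈-IsPerm⁺ {x = suc x} σ-perm _ x≤n = ∈-resp-↭ (↭-sym σ-perm) (∈-map⁺ suc (∈-upTo⁺ x≤n))

IsPerm⇒Unique : ∀ {σ} → IsPerm σ → Unique σ
IsPerm⇒Unique {σ} σ-perm =
  Unique-resp-↭ (↭-sym σ-perm) (Unique.map⁺ suc-injective (Unique.upTo⁺ (length σ)))

IsPerm⇒positive : ∀ {σ} → IsPerm σ → All (0 <_) σ
IsPerm⇒positive σ-perm = all-tabulate (proj₁ ∘ ∈-IsPerm⁻ σ-perm)

IsPerm⇒length≤ : ∀ {σ c} → IsPerm σ → (∀ {a} → a ∈ σ → a ≤ c) → length σ ≤ c
IsPerm⇒length≤ {σ} {c} σ-perm bounded = below (length σ) refl
  where
  below : ∀ n → n ≡ length σ → n ≤ c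
  below zero    _  = z≤n
  below (suc n) eq = bounded (∈-IsPerm⁺ σ-perm (s≤s z≤n) (≤-reflexive eq))

record Occurrence (σ ρ : List ℕ) : Set where
  field
    pairs     : List (ℕ × ℕ)
    map-proj₁ : map proj₁ pairs ≡ σ
    map-proj₂ : map proj₂ pairs ⊆ ρ
    order-iso : ∀ {a b a′ b′} → (a , b) ∈ pairs → (a′ , b′) ∈ pairs → (b < b′) ⇔ (a < a′)

Contains⇒Occurrence : ∀ {ρ σ} → Contains ρ σ → Occurrence σ ρ
Contains⇒Occurrence {ρ} {σ} (τ , τ⊆ρ , eq , iso) = record
  { pairs     = tabulate entry
  ; map-proj₁ = trans (map-tabulate entry proj₁) (tabulate-lookup σ)
  ; map-proj₂ = subst (_⊆ ρ) (sym (trans (map-tabulate entry proj₂) (tabulate-lookup-cast τ eq))) τ⊆ρ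
  ; order-iso = order-iso
  }
  where
  entry : Fin (length σ) → ℕ × ℕ
  entry i = lookup σ i , lookup τ (cast eq i)
  order-iso : ∀ {a b a′ b′} → (a , b) ∈ tabulate entry → (a′ , b′) ∈ tabulate entry →
              (b < b′) ⇔ (a < a′)
  order-iso ab∈ a′b′∈ with ∈-tabulate⁻ ab∈ | ∈-tabulate⁻ a′b′∈
  ... | i , refl | j , refl = iso i j

-- One pass of the stack

oneTo : ℕ → List ℕ
oneTo c = map suc (upTo c)

oneTo-∷ʳ : ∀ c → oneTo c ++ [ suc c ] ≡ oneTo (suc c)
oneTo-∷ʳ c = trans (sym (map-++ suc (upTo c) [ c ])) (cong (map suc) (upTo-∷ʳ c))

length-oneTo : ∀ c → length (oneTo c) ≡ c
length-oneTo c = trans (length-map suc (upTo c)) (length-upTo c)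

stage : ℕ → List ℕ → State
stage c ρ = st (suc c) (oneTo c) (filter (c <?_) ρ)

∈-filter-<⁻ : ∀ {c v} r → v ∈ filter (c <?_) r → c < v
∈-filter-<⁻ {c} r = proj₂ ∘ ∈-filter⁻ (c <?_) {xs = r}

Blocked : List ℕ → ℕ → Set
Blocked w v = ∃₂ λ a y → (v ∷ a ∷ y ∷ []) ⊆ w × y < v × v < a

-- Blocked, read on the entries pushed so far listed most recent first (as the stack is).
Buried : List ℕ → ℕ → Set
Buried r v = ∃₂ λ a y → (y ∷ a ∷ v ∷ []) ⊆ r × y < v × v < a

Blocked⇒Buried : ∀ {w v} → Blocked w v → Buried (reverse w) v
Blocked⇒Buried (a , y , sub , y<v , v<a) = a , y , Sublist.reverse⁺ sub , y<v , v<a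

Buried⇒Blocked : ∀ {w v} → Buried (reverse w) v → Blocked w v
Buried⇒Blocked {w} (a , y , sub , y<v , v<a) =
  a , y , subst (_ ⊆_) (reverse-involutive w) (Sublist.reverse⁺ sub) , y<v , v<a

Blocked⇒∈ : ∀ {w v} → Blocked w v → v ∈ w
Blocked⇒∈ (_ , _ , sub , _) = ∈-resp-⊆ sub (here refl)

Buried-∷⁺ : ∀ {x r v} → Buried r v → Buried (x ∷ r) v
Buried-∷⁺ (a , y , sub , y<v , v<a) = a , y , _ ∷ʳ sub , y<v , v<a

Buried-∷⁻ : ∀ {x r v} → Buried (x ∷ r) v → Buried r v ⊎ x < v
Buried-∷⁻ (a , y , _ ∷ʳ sub , y<v , v<a) = inj₁ (a , y , sub , y<v , v<a)
Buried-∷⁻ (a , y , refl ∷ _ , y<v , _)  = inj₂ y<v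

filter-<-drop-head : ∀ {c s} r → Unique r → filter (c <?_) r ≡ suc c ∷ s → filter (suc c <?_) r ≡ s
filter-<-drop-head {c} {s} r u eq = begin
  filter (suc c <?_) r                    ≡⟨ filter-filter-⇒ (c <?_) (suc c <?_) (<-trans (n<1+n c)) r ⟨
  filter (suc c <?_) (filter (c <?_) r)   ≡⟨ cong (filter (suc c <?_)) eq ⟩
  filter (suc c <?_) (suc c ∷ s)          ≡⟨ filter-reject (suc c <?_) (<-irrefl refl) ⟩
  filter (suc c <?_) s                    ≡⟨ filter-all (suc c <?_) (all-tabulate above) ⟩
  s                                       ∎
  where
  open ≡-Reasoning
  c+1∉s : suc c ∉ s
  c+1∉s = Unique.Unique[x∷xs]⇒x∉xs (subst Unique eq (Unique.filter⁺ (c <?_) u))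
  above : ∀ {x} → x ∈ s → suc c < x
  above {x} x∈s = ≤∧≢⇒< (∈-filter-<⁻ r (subst (x ∈_) (sym eq) (there x∈s)))
                        (λ c+1≡x → c+1∉s (subst (_∈ s) (sym c+1≡x) x∈s))

-- An entry above suc c pushed after it would still lie above it on the stack.
head-unburied : ∀ {c s} r → Unique r → filter (c <?_) r ≡ suc c ∷ s → ¬ Buried r (suc c)
head-unburied {c} r u eq (a , y , sub , _ , c+1<a)
  with subst ((a ∷ suc c ∷ []) ⊆_) eq
         (⊆-filter⁺ (c <?_) (Sublist.∷ˡ⁻ sub) (<-trans (n<1+n c) c+1<a ∷ n<1+n c ∷ []))
... | refl ∷ _      = <-irrefl refl c+1<a
... | _ ∷ʳ a∷c+1⊆s = Unique.Unique[x∷xs]⇒x∉xs (subst Unique eq (Unique.filter⁺ (c <?_) u))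
                                              (∈-resp-⊆ a∷c+1⊆s (there (here refl)))

-- In a pass begun with 1,…,c₀ output, r lists the entries pushed so far, most recent
-- first, and 1,…,c have been output.
record Popped (c₀ : ℕ) (r : List ℕ) (c : ℕ) : Set where
  field
    c₀≤c     : c₀ ≤ c
    pushed   : ∀ {v} → c₀ < v → v ≤ c → v ∈ r
    unburied : ∀ {v} → c₀ < v → v ≤ c → ¬ Buried r v
open Popped

Popped-suc : ∀ {c₀ c s} r → Unique r → filter (c <?_) r ≡ suc c ∷ s →
             Popped c₀ r c → Popped c₀ r (suc c)
Popped-suc {c = c} r u eq p = record
  { c₀≤c     = m≤n⇒m≤1+n (c₀≤c p)
  ; pushed   = λ c₀<v v≤c+1 → ≤-suc-cases v≤c+1 (pushed p c₀<v) λ { refl → c+1∈r }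
  ; unburied = λ c₀<v v≤c+1 → ≤-suc-cases v≤c+1 (unburied p c₀<v) λ { refl → head-unburied r u eq }
  }
  where
  ≤-suc-cases : ∀ {v} {R : Set} → v ≤ suc c → (v ≤ c → R) → (v ≡ suc c → R) → R
  ≤-suc-cases v≤c+1 below top with m≤n⇒m<n∨m≡n v≤c+1
  ... | inj₁ v<c+1 = below (s≤s⁻¹ v<c+1)
  ... | inj₂ v≡c+1 = top v≡c+1
  c+1∈r : suc c ∈ r
  c+1∈r = proj₁ (∈-filter⁻ (c <?_) {xs = r} (subst (suc c ∈_) (sym eq) (here refl)))

Popped⇒above : ∀ {c₀ x r c} → Unique (x ∷ r) → c₀ < x → Popped c₀ r c → c < x
Popped⇒above {x = x} {c = c} u c₀<x p with x ≤? c
... | yes x≤c = ⊥-elim (Unique.Unique[x∷xs]⇒x∉xs u (pushed p c₀<x x≤c))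
... | no  x≰c = ≰⇒> x≰c

Popped-∷ : ∀ {c₀ x r c} → Unique (x ∷ r) → c₀ < x → Popped c₀ r c → Popped c₀ (x ∷ r) c
Popped-∷ {x = x} {c = c} u c₀<x p = record
  { c₀≤c     = c₀≤c p
  ; pushed   = λ c₀<v v≤c → there (pushed p c₀<v v≤c)
  ; unburied = λ c₀<v v≤c buried → [ unburied p c₀<v v≤c , x≮v v≤c ]′ (Buried-∷⁻ buried)
  }
  where
  x≮v : ∀ {v} → v ≤ c → ¬ x < v
  x≮v v≤c x<v = <-irrefl refl (<-trans (Popped⇒above u c₀<x p) (<-≤-trans x<v v≤c))

record PassInvariant (c₀ : ℕ) (r : List ℕ) (t : ℕ × List ℕ × List ℕ) : Set where
  field
    count       : ℕ
    state≡      : t ≡ (suc count , oneTo count , filter (count <?_) r)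
    popped      : Popped c₀ r count
    next-buried : suc count ∈ r → Buried r (suc count)
open PassInvariant

filter-<-head-above : ∀ {c t s} r → filter (c <?_) r ≡ t ∷ s → c < t
filter-<-head-above {t = t} r eq = ∈-filter-<⁻ r (subst (t ∈_) (sym eq) (here refl))

-- The entry x popped last and the top t bury suc c.
pop-stopped-buried : ∀ {x r c t s} → x ≤ c → filter (c <?_) (x ∷ r) ≡ t ∷ s → t ≢ suc c →
                     suc c ∈ x ∷ r → Buried (x ∷ r) (suc c)
pop-stopped-buried {x} {r} {c} {t} x≤c eq t≢c+1 c+1∈
  with subst (suc c ∈_) eq (∈-filter⁺ (c <?_) c+1∈ (n<1+n c))
... | here c+1≡t = ⊥-elim (t≢c+1 (sym c+1≡t))
... | there c+1∈s
  with ⊆-trans (subst ((t ∷ suc c ∷ []) ⊆_) (sym eq) (refl ∷ from∈ c+1∈s))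
               (Sublist.filter-⊆ (c <?_) (x ∷ r))
...   | refl ∷ _      = ⊥-elim (<-irrefl refl (≤-<-trans x≤c (filter-<-head-above (x ∷ r) eq)))
...   | _ ∷ʳ t∷c+1⊆r =
  t , x , refl ∷ t∷c+1⊆r , s≤s x≤c , ≤∧≢⇒< (filter-<-head-above (x ∷ r) eq) (t≢c+1 ∘ sym)

popAll-invariant : ∀ {c₀ x r} c s → Unique (x ∷ r) → x ≤ c → filter (c <?_) (x ∷ r) ≡ s →
                   Popped c₀ (x ∷ r) c → PassInvariant c₀ (x ∷ r) (popAll (suc c) (oneTo c) s)
popAll-invariant c [] u x≤c eq p = record
  { count = c ; state≡ = cong (λ s → suc c , oneTo c , s) (sym eq) ; popped = p
  ; next-buried = λ c+1∈ → case subst (suc c ∈_) eq (∈-filter⁺ (c <?_) c+1∈ (n<1+n c)) of λ () }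
popAll-invariant {x = x} {r} c (t ∷ s) u x≤c eq p with t ≟ suc c
... | yes refl rewrite oneTo-∷ʳ c =
  popAll-invariant (suc c) s u (m≤n⇒m≤1+n x≤c) (filter-<-drop-head (x ∷ r) u eq)
                   (Popped-suc (x ∷ r) u eq p)
... | no t≢c+1 = record
  { count = c ; state≡ = cong (λ s → suc c , oneTo c , s) (sym eq) ; popped = p
  ; next-buried = pop-stopped-buried x≤c eq t≢c+1 }

push-invariant : ∀ {c₀ x r nx out s} → Unique (x ∷ r) → c₀ < x → PassInvariant c₀ r (nx , out , s) →
                 PassInvariant c₀ (x ∷ r) (popAll nx out (x ∷ s))
push-invariant {x = x} {r} u c₀<x record { count = c ; state≡ = refl ; popped = p ; next-buried = nb }
  with x ≟ suc c
... | yes refl rewrite oneTo-∷ʳ c =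
  popAll-invariant (suc c) _ u ≤-refl (filter-<-drop-head (x ∷ r) u x-head)
                   (Popped-suc (x ∷ r) u x-head (Popped-∷ u c₀<x p))
  where
  x-head : filter (c <?_) (x ∷ r) ≡ x ∷ filter (c <?_) r
  x-head = filter-accept (c <?_) (n<1+n c)
... | no x≢c+1 = record
  { count       = c
  ; state≡      = cong (λ s → suc c , oneTo c , s) (sym (filter-accept (c <?_) (Popped⇒above u c₀<x p)))
  ; popped      = Popped-∷ u c₀<x p
  ; next-buried = λ { (here c+1≡x)  → ⊥-elim (x≢c+1 (sym c+1≡x))
                    ; (there c+1∈r) → Buried-∷⁺ (nb c+1∈r) }
  }

pushAll-invariant : ∀ {c₀} xs r {nx out s} → Unique (xs ʳ++ r) → All (c₀ <_) xs →
                    PassInvariant c₀ r (nx , out , s) → PassInvariant c₀ (xs ʳ++ r) (pushAll nx out s xs)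
pushAll-invariant []       r u []               I = I
pushAll-invariant (x ∷ xs) r {nx} {out} {s} u (c₀<x ∷ c₀<xs) I
  with popAll nx out (x ∷ s) | push-invariant (Unique-ʳ++⁻ xs u) c₀<x I
... | _ | I′ = pushAll-invariant xs (x ∷ r) u c₀<xs I′

pass-≡ : ∀ {nx out inp nx′ out′ s′} → pushAll nx out [] inp ≡ (nx′ , out′ , s′) →
         pass (st nx out inp) ≡ st nx′ out′ (reverse s′)
pass-≡ {nx} {out} {inp} eq with pushAll nx out [] inp
pass-≡ refl | _ = refl

record PassOutcome (c : ℕ) (ρ : List ℕ) : Set where
  field
    c′         : ℕ
    pass-stage : pass (stage c ρ) ≡ stage c′ ρ
    c≤c′       : c ≤ c′
    output∈    : ∀ {v} → c < v → v ≤ c′ → v ∈ ρ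
    unblocked  : ∀ {v} → c < v → v ≤ c′ → ¬ Blocked (filter (c <?_) ρ) v
    blocked    : suc c′ ∈ ρ → Blocked (filter (c <?_) ρ) (suc c′)

pass-outcome : ∀ c {ρ} → Unique ρ → PassOutcome c ρ
pass-outcome c {ρ} u = record
  { c′         = c′
  ; pass-stage = trans (pass-≡ {inp = w} (state≡ I)) (cong (st _ _) remaining)
  ; c≤c′       = c≤c′
  ; output∈    = λ c<v v≤c′ →
      proj₁ (∈-filter⁻ (c <?_) (Any.reverse⁻ (pushed (popped I) c<v v≤c′)))
  ; unblocked  = λ c<v v≤c′ → unburied (popped I) c<v v≤c′ ∘ Blocked⇒Buried
  ; blocked    = λ c′+1∈ρ →
      Buried⇒Blocked (next-buried I (Any.reverse⁺ (∈-filter⁺ (c <?_) c′+1∈ρ (s≤s c≤c′))))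
  }
  where
  w : List ℕ
  w = filter (c <?_) ρ
  empty-range : ∀ {v} {R : Set} → c < v → v ≤ c → R
  empty-range c<v v≤c = ⊥-elim (<-irrefl refl (<-≤-trans c<v v≤c))
  start : PassInvariant c [] (suc c , oneTo c , [])
  start = record
    { count = c ; state≡ = refl ; next-buried = λ ()
    ; popped = record { c₀≤c = ≤-refl ; pushed = empty-range ; unburied = empty-range } }
  I : PassInvariant c (reverse w) (pushAll (suc c) (oneTo c) [] w)
  I = pushAll-invariant w [] (Unique-resp-↭ (↭-sym (↭-reverse w)) (Unique.filter⁺ (c <?_) u))
                        (all-filter (c <?_) ρ) start
  c′ : ℕ
  c′ = count I
  c≤c′ : c ≤ c′
  c≤c′ = c₀≤c (popped I)
  remaining : reverse (filter (c′ <?_) (reverse w)) ≡ filter (c′ <?_) ρ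
  remaining = begin
    reverse (filter (c′ <?_) (reverse w))  ≡⟨ cong reverse (filter-reverse (c′ <?_) w) ⟩
    reverse (reverse (filter (c′ <?_) w))  ≡⟨ reverse-involutive _ ⟩
    filter (c′ <?_) w                      ≡⟨ filter-filter-⇒ (c <?_) (c′ <?_) (≤-<-trans c≤c′) ρ ⟩
    filter (c′ <?_) ρ                      ∎
    where open ≡-Reasoning

PassOutcome-c′≤length : ∀ {c σ} → IsPerm σ → c ≤ length σ → (O : PassOutcome c σ) →
                        PassOutcome.c′ O ≤ length σ
PassOutcome-c′≤length {σ = σ} σ-perm c≤n O with PassOutcome.c′ O ≤? length σ
... | yes c′≤n = c′≤n
... | no  c′≰n = ⊥-elim (<-irrefl refl (proj₂ (∈-IsPerm⁻ σ-perm n+1∈σ)))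
  where
  n+1∈σ : suc (length σ) ∈ σ
  n+1∈σ = PassOutcome.output∈ O (s≤s c≤n) (≰⇒> c′≰n)

-- Comparing the runs on ρ and σ

module Simulation {ρ σ} (ρ-perm : IsPerm ρ) (σ-perm : IsPerm σ) (occ : Occurrence σ ρ) where
  open Occurrence occ

  KeepsUp : ℕ → ℕ → Set
  KeepsUp cρ cσ = ∀ {a b} → (a , b) ∈ pairs → b ≤ cρ → a ≤ cσ

  fst∈σ : ∀ {a b} → (a , b) ∈ pairs → a ∈ σ
  fst∈σ ab∈ = subst (_ ∈_) map-proj₁ (∈-map⁺ proj₁ ab∈)

  snd∈ρ : ∀ {a b} → (a , b) ∈ pairs → b ∈ ρ
  snd∈ρ ab∈ = ∈-resp-⊆ map-proj₂ (∈-map⁺ proj₂ ab∈)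

  blocked-lifts : ∀ {cρ cσ v} → KeepsUp cρ cσ → Blocked (filter (cσ <?_) σ) v →
                  ∃ λ u → (v , u) ∈ pairs × Blocked (filter (cρ <?_) ρ) u
  blocked-lifts {cρ} {cσ} {v} keeps (a , y , sub , y<v , v<a)
    with ⊆-map⁻ proj₁ pairs (subst (_ ⊆_) (sym map-proj₁) (⊆-trans sub (Sublist.filter-⊆ (cσ <?_) σ)))
  ... | (_ , u) ∷ (_ , b₂) ∷ (_ , b₁) ∷ [] , ys⊆pairs , refl =
    u , vu∈ , b₂ , b₁ , ⊆-filter⁺ (cρ <?_) lifted (cρ<u ∷ <-trans cρ<u u<b₂ ∷ cρ<b₁ ∷ [])
      , b₁<u , u<b₂
    where
    lifted : (u ∷ b₂ ∷ b₁ ∷ []) ⊆ ρ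
    lifted = ⊆-trans (Sublist.map⁺ proj₂ ys⊆pairs) map-proj₂
    vu∈ : (v , u) ∈ pairs
    vu∈ = ∈-resp-⊆ ys⊆pairs (here refl)
    ab₂∈ : (a , b₂) ∈ pairs
    ab₂∈ = ∈-resp-⊆ ys⊆pairs (there (here refl))
    yb₁∈ : (y , b₁) ∈ pairs
    yb₁∈ = ∈-resp-⊆ ys⊆pairs (there (there (here refl)))
    b₁<u : b₁ < u
    b₁<u = Equivalence.from (order-iso yb₁∈ vu∈) y<v
    u<b₂ : u < b₂
    u<b₂ = Equivalence.from (order-iso vu∈ ab₂∈) v<a
    cσ<y : cσ < y
    cσ<y = ∈-filter-<⁻ σ (∈-resp-⊆ sub (there (there (here refl))))
    cρ<b₁ : cρ < b₁
    cρ<b₁ = ≰⇒> (λ b₁≤cρ → <-irrefl refl (<-≤-trans cσ<y (keeps yb₁∈ b₁≤cρ)))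
    cρ<u : cρ < u
    cρ<u = <-trans cρ<b₁ b₁<u

  -- If σ's pass stopped below an entry a whose partner b was output from ρ, the entry σ
  -- stopped at is blocked, and its partner u ≤ b would be a blocked entry output from ρ.
  KeepsUp-pass : ∀ {cρ cσ} → KeepsUp cρ cσ → (Oρ : PassOutcome cρ ρ) (Oσ : PassOutcome cσ σ) →
                 KeepsUp (PassOutcome.c′ Oρ) (PassOutcome.c′ Oσ)
  KeepsUp-pass {cρ} keeps Oρ Oσ {a} {b} ab∈ b≤c′ρ with a ≤? PassOutcome.c′ Oσ
  ... | yes a≤c′σ = a≤c′σ
  ... | no  a≰c′σ = ⊥-elim (partner-unblocked (blocked-lifts keeps (PassOutcome.blocked Oσ v∈σ)))
    where
    v≤a : suc (PassOutcome.c′ Oσ) ≤ a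
    v≤a = ≰⇒> a≰c′σ
    v∈σ : suc (PassOutcome.c′ Oσ) ∈ σ
    v∈σ = ∈-IsPerm⁺ σ-perm (s≤s z≤n) (≤-trans v≤a (proj₂ (∈-IsPerm⁻ σ-perm (fst∈σ ab∈))))
    partner-unblocked : ¬ ∃ λ u → (suc (PassOutcome.c′ Oσ) , u) ∈ pairs × Blocked (filter (cρ <?_) ρ) u
    partner-unblocked (u , vu∈ , u-blocked) =
      PassOutcome.unblocked Oρ (∈-filter-<⁻ ρ (Blocked⇒∈ u-blocked)) (≤-trans u≤b b≤c′ρ) u-blocked
      where
      u≤b : u ≤ b
      u≤b = ≮⇒≥ (λ b<u → <-irrefl refl (<-≤-trans (Equivalence.to (order-iso ab∈ vu∈) b<u) v≤a))

  record Related (sρ sσ : State) : Set where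
    field
      cρ cσ     : ℕ
      sρ≡       : sρ ≡ stage cρ ρ
      sσ≡       : sσ ≡ stage cσ σ
      cσ≤length : cσ ≤ length σ
      keeps-up  : KeepsUp cρ cσ

  initial-Related : Related (initial ρ) (initial σ)
  initial-Related = record
    { cρ = 0 ; cσ = 0
    ; sρ≡ = cong (st 1 []) (sym (filter-all (0 <?_) (IsPerm⇒positive ρ-perm)))
    ; sσ≡ = cong (st 1 []) (sym (filter-all (0 <?_) (IsPerm⇒positive σ-perm)))
    ; cσ≤length = z≤n
    ; keeps-up = λ ab∈ b≤0 →
        ⊥-elim (<-irrefl refl (<-≤-trans (proj₁ (∈-IsPerm⁻ ρ-perm (snd∈ρ ab∈))) b≤0))
    }

  pass-Related : ∀ {sρ sσ} → Related sρ sσ → Related (pass sρ) (pass sσ)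
  pass-Related record { cρ = cρ ; cσ = cσ ; sρ≡ = refl ; sσ≡ = refl
                      ; cσ≤length = cσ≤n ; keeps-up = keeps } =
    record
      { sρ≡       = PassOutcome.pass-stage Oρ
      ; sσ≡       = PassOutcome.pass-stage Oσ
      ; cσ≤length = PassOutcome-c′≤length σ-perm cσ≤n Oσ
      ; keeps-up  = KeepsUp-pass keeps Oρ Oσ
      }
    where
    Oρ : PassOutcome cρ ρ
    Oρ = pass-outcome cρ (IsPerm⇒Unique ρ-perm)
    Oσ : PassOutcome cσ σ
    Oσ = pass-outcome cσ (IsPerm⇒Unique σ-perm)

  passes-Related : ∀ k {sρ sσ} → Related sρ sσ → Related (passes k sρ) (passes k sσ)
  passes-Related zero    R = R
  passes-Related (suc k) R = passes-Related k (pass-Related R)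

  SortableIn-transfer : ∀ k → SortableIn k ρ → SortableIn k σ
  SortableIn-transfer k sortable = begin
    out (passes k (initial σ)) ≡⟨ cong out sσ≡ ⟩
    oneTo cσ                   ≡⟨ cong oneTo (≤-antisym cσ≤length (IsPerm⇒length≤ σ-perm σ-output)) ⟩
    oneTo (length σ)           ∎
    where
    open ≡-Reasoning
    open Related (passes-Related k initial-Related)
    cρ≡n : cρ ≡ length ρ
    cρ≡n = begin
      cρ                                  ≡⟨ length-oneTo cρ ⟨
      length (out (stage cρ ρ))           ≡⟨ cong (length ∘ out) sρ≡ ⟨
      length (out (passes k (initial ρ))) ≡⟨ cong length sortable ⟩
      length (oneTo (length ρ))           ≡⟨ length-oneTo (length ρ) ⟩
      length ρ                            ∎
    σ-output : ∀ {a} → a ∈ σ → a ≤ cσ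
    σ-output a∈σ with ∈-map⁻ proj₁ (subst (_ ∈_) (sym map-proj₁) a∈σ)
    ... | (a , b) , ab∈ , refl =
      keeps-up ab∈ (subst (b ≤_) (sym cρ≡n) (proj₂ (∈-IsPerm⁻ ρ-perm (snd∈ρ ab∈))))

corollary2p7 : ∀ (k : ℕ) → 1 ≤ k → IsPermClass (SortableIn k)
corollary2p7 k _ ρ σ ρ-perm σ-perm sortable ρ∋σ =
  Simulation.SortableIn-transfer ρ-perm σ-perm (Contains⇒Occurrence ρ∋σ) k sortable
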